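{- There is no Turing machine that, upon input of the code of an arbitrary computable binary-valued function class $\mathcal{G}\subseteq\{0,1\}^{\mathbb{N}}$, decides whether $\operatorname{Ldim}(\mathcal{G})<\infty$. That is, finiteness of the Littlestone dimension is Turing undecidable.
   Context: $\mathbb{N}=\{0,1,2,\dots\}$. A class $\mathcal{G}\subseteq\mathbb{N}^{\mathbb{N}}$ is computable if there is a total computable $G:\mathbb{N}\times\mathbb{N}\to\mathbb{N}$ with $\mathcal{G}=\{n\mapsto G(m,n): m\in\mathbb{N}\}$; the code of the class is the code of $G$ with respect to a fixed universal Turing machine. A set of points $\{x_{\mathbf v}\}_{\mathbf v\in\{0,1\}^k, 0\le k<d}\subseteq\mathcal{X}$ indexed by nodes of a complete binary tree is a Littlestone tree of depth $d\le\infty$ of $\mathcal{G}\subseteq\{0,1\}^{\mathcal{X}}$ if for every $y_1,y_2,\dots\in\{0,1\}$ and every $0\le n<d$ there is $g\in\mathcal{G}$ with $g(x_{y_1\dots y_k})=y_{k+1}$ for all $0\le k\le n$. The Littlestone dimension is $\operatorname{Ldim}(\mathcal{G})=\sup\{d\in\mathbb{N}: \mathcal{G}\text{ has a Littlestone tree of depth }d\}$. -}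

module Defs where

open import Data.Nat using (ℕ; zero; suc; _≤_; _<_; _≟_)
open import Data.Bool using (Bool; true; false; if_then_else_)
open import Data.List using (List; []; _∷_)
open import Data.Maybe using (Maybe; just; nothing)
open import Data.Product using (Σ; ∃; _×_; _,_; proj₁; proj₂)
open import Data.Sum using (_⊎_)
open import Relation.Nullary using (¬_; does)
open import Relation.Binary.PropositionalEquality using (_≡_)

-- Model of computation: register (counter / Minsky) machines, a standard
-- Turing-complete model.  Programs are lists of instructions; a program
-- halts when the program counter leaves the program.  Inputs are placed
-- in registers 0,1,..., all other registers are 0; the output is the
-- content of register 0 at halting.

data Instr : Set where
  inc   : ℕ → Instr
  decjz : ℕ → ℕ → Instr      -- if register r is 0 jump to j, else decrement and go on

Program : Set
Program = List Instr

lookupInstr : Program → ℕ → Maybe Instr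
lookupInstr []      _       = nothing
lookupInstr (i ∷ p) zero    = just i
lookupInstr (i ∷ p) (suc n) = lookupInstr p n

update : (ℕ → ℕ) → ℕ → ℕ → (ℕ → ℕ)
update R r v k = if does (k ≟ r) then v else R k

-- run with a step budget (fuel); 'just v' = halted with output v
run : ℕ → Program → ℕ → (ℕ → ℕ) → Maybe ℕ
run zero    p pc R = nothing
run (suc t) p pc R with lookupInstr p pc
... | nothing = just (R 0)
... | just (inc r) = run t p (suc pc) (update R r (suc (R r)))
... | just (decjz r j) with R r
...   | zero  = run t p j R
...   | suc v = run t p (suc pc) (update R r v)

initRegs : List ℕ → (ℕ → ℕ)
initRegs []       _       = 0
initRegs (x ∷ xs) zero    = x
initRegs (x ∷ xs) (suc k) = initRegs xs k

-- Gödel numbering (the fixed acceptable enumeration of machines).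
-- Cantor unpairing by enumerating ℕ×ℕ along anti-diagonals.

nextPair : ℕ × ℕ → ℕ × ℕ
nextPair (zero  , b) = (suc b , 0)
nextPair (suc a , b) = (a , suc b)

unpair : ℕ → ℕ × ℕ
unpair zero    = (0 , 0)
unpair (suc n) = nextPair (unpair n)

decodeInstr : ℕ → Instr
decodeInstr a with unpair a
... | (zero  , c) = inc c
... | (suc _ , c) = decjz (proj₁ (unpair c)) (proj₂ (unpair c))

-- first argument is fuel (initialised to the code, which suffices)
decodeProg : ℕ → ℕ → Program
decodeProg zero    _       = []
decodeProg (suc f) zero    = []
decodeProg (suc f) (suc n) = decodeInstr (proj₁ (unpair n)) ∷ decodeProg f (proj₂ (unpair n))

decode : ℕ → Program
decode e = decodeProg e e

Computes : ℕ → List ℕ → ℕ → Set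
Computes e xs v = Σ ℕ λ t → run t (decode e) 0 (initRegs xs) ≡ just v

-- Computable binary-valued classes: e codes a total G : ℕ × ℕ → {0,1}.

IsClassCode : ℕ → Set
IsClassCode e = (m n : ℕ) → Σ ℕ λ v → Computes e (m ∷ n ∷ []) v × v ≤ 1

classOf : {e : ℕ} → IsClassCode e → ℕ → ℕ → ℕ
classOf h m n = proj₁ (h m n)

bit : Bool → ℕ
bit true  = 1
bit false = 0

-- the node label y₁…y_k (0-indexed: y 0, …, y (k-1))
prefix : (ℕ → Bool) → ℕ → List Bool
prefix y zero    = []
prefix y (suc k) = y 0 ∷ prefix (λ i → y (suc i)) k

-- x : nodes (binary strings) → points, a Littlestone tree of depth d
IsLittlestoneTree : (ℕ → ℕ → ℕ) → ℕ → (List Bool → ℕ) → Set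
IsLittlestoneTree G d x =
  (y : ℕ → Bool) (n : ℕ) → n < d →
  ∃ λ m → (k : ℕ) → k ≤ n → G m (x (prefix y k)) ≡ bit (y k)

HasLittlestoneTree : (ℕ → ℕ → ℕ) → ℕ → Set
HasLittlestoneTree G d = ∃ λ x → IsLittlestoneTree G d x

LdimFinite : (ℕ → ℕ → ℕ) → Set
LdimFinite G = ∃ λ D → (d : ℕ) → HasLittlestoneTree G d → d ≤ D

DecidesLdimFinite : ℕ → Set
DecidesLdimFinite D =
  (e : ℕ) (h : IsClassCode e) →
    (Computes D (e ∷ []) 1 × LdimFinite (classOf h))
  ⊎ (Computes D (e ∷ []) 0 × ¬ LdimFinite (classOf h))

-- Suppose the machine d decided finiteness of the Littlestone dimension. By self-reference we
-- build a class code e whose machine, on input (m, n), runs d on e for n + 1 steps and outputs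
-- [n < m] if d has answered 1 ("finite") by then, and 0 otherwise. If d answers 1 at time t₀,
-- the class agrees with the thresholds x ↦ [x < m] at all points x ≥ t₀, and binary search
-- among thresholds gives Littlestone trees of every depth there, so the dimension is infinite.
-- If d answers 0, every function of the class is 0 and the dimension is 0. Either way d errs on e.
--
-- The self-reference is a quine: the program is B ++ (inc 2)ᵏ ++ [decjz 3 1], where k is the
-- code of B reversed. B first runs this tail, which leaves k in register 2, then turns k into the
-- code of the tail and, by unpacking k instruction by instruction, into the code of the whole
-- program. Instead of a universal machine, B contains d's own program, compiled with a fuel counter.

module Submission where

open import Defs
open import Data.Bool using (Bool; true; false; if_then_else_; T)
open import Data.Empty using (⊥)
open import Data.List using (List; []; _∷_; _++_; length; replicate; map; take; drop; reverse; _ʳ++_)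
open import Data.List.Properties
  using (∷-injectiveˡ; ∷-injectiveʳ; length-map; length-++; ʳ++-defn; reverse-involutive; length-replicate)
open import Data.Maybe using (Maybe; just; nothing)
open import Data.Maybe.Properties using (just-injective)
open import Data.Nat
open import Data.Nat.GeneralisedArithmetic using (fold; iterate; iterate-is-fold)
open import Data.Nat.Properties
open import Data.Nat.Tactic.RingSolver using (solve-∀)
open import Data.Product using (Σ; ∃; _×_; _,_; proj₁; proj₂)
open import Data.Sum using (_⊎_; inj₁; inj₂)
open import Data.Unit using (⊤; tt)
open import Function using (_∘_)
open import Relation.Binary.PropositionalEquality
open import Relation.Nullary using (¬_; yes; no; does; contradiction)

-- Littlestone trees of threshold classes

threshold : ℕ → ℕ → ℕ
threshold m x = bit (x <ᵇ m)

bit≤1 : ∀ b → bit b ≤ 1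
bit≤1 true  = s≤s z≤n
bit≤1 false = z≤n

threshold-< : ∀ {x m} → x < m → threshold m x ≡ 1
threshold-< {zero}  {suc m} _         = refl
threshold-< {suc x} {suc m} (s≤s x<m) = threshold-< x<m

threshold-≥ : ∀ {x m} → m ≤ x → threshold m x ≡ 0
threshold-≥ {x}     {zero}  _         = refl
threshold-≥ {suc x} {suc m} (s≤s m≤x) = threshold-≥ m≤x

-- The root a + width d of a tree of depth d + 1 splits the window [a, a + width (d + 1)) of
-- thresholds into the two windows of width (width d) that the subtrees use.
width : ℕ → ℕ
width zero    = 1
width (suc d) = suc (width d + width d)

subwindow : ℕ → ℕ → Bool → ℕ
subwindow d a false = a
subwindow d a true  = suc (a + width d)

bisection : ℕ → ℕ → List Bool → ℕ
bisection zero    a v       = a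
bisection (suc d) a []      = a + width d
bisection (suc d) a (b ∷ v) = bisection d (subwindow d a b) v

subwindow-≥ : ∀ d a b → a ≤ subwindow d a b
subwindow-≥ d a false = ≤-refl
subwindow-≥ d a true  = ≤-trans (m≤m+n a (width d)) (n≤1+n _)

bisection-≥ : ∀ d a v → a ≤ bisection d a v
bisection-≥ zero    a v       = ≤-refl
bisection-≥ (suc d) a []      = m≤m+n a (width d)
bisection-≥ (suc d) a (b ∷ v) = ≤-trans (subwindow-≥ d a b) (bisection-≥ d _ v)

subwindow-root : ∀ d a b {m} → subwindow d a b ≤ m → m < subwindow d a b + width d →
                 threshold m (a + width d) ≡ bit b × m < a + width (suc d)
subwindow-root d a false lo hi =
  threshold-≥ (<⇒≤ hi) , <-≤-trans hi (+-monoʳ-≤ a (≤-trans (m≤m+n (width d) (width d)) (n≤1+n _)))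
subwindow-root d a true {m} lo hi = threshold-< lo , subst (m <_) (upper-end a (width d)) hi
  where
  upper-end : ∀ a w → suc (a + w) + w ≡ a + suc (w + w)
  upper-end = solve-∀

bisection-realises : ∀ d a (y : ℕ → Bool) → ∃ λ m → a ≤ m × m < a + width d ×
                     (∀ k → k < d → threshold m (bisection d a (prefix y k)) ≡ bit (y k))
bisection-realises zero    a y = a , ≤-refl , m<m+n a z<s , λ _ ()
bisection-realises (suc d) a y =
  let m , lo , hi , path = bisection-realises d (subwindow d a (y 0)) (y ∘ suc)
      root , hi′ = subwindow-root d a (y 0) lo hi
  in m , ≤-trans (subwindow-≥ d a (y 0)) lo , hi′ , λ { zero _ → root ; (suc k) (s≤s k<d) → path k k<d }

eventually-thresholds-ldim-infinite : ∀ (G : ℕ → ℕ → ℕ) t₀ → (∀ m x → t₀ ≤ x → G m x ≡ threshold m x) →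
                                      ¬ LdimFinite G
eventually-thresholds-ldim-infinite G t₀ agrees (D , bounded) = 1+n≰n (bounded (suc D) (bisection (suc D) t₀ , tree))
  where
  tree : IsLittlestoneTree G (suc D) (bisection (suc D) t₀)
  tree y n n<D =
    let m , _ , _ , path = bisection-realises (suc D) t₀ y
    in m , λ k k≤n → trans (agrees m _ (bisection-≥ (suc D) t₀ (prefix y k))) (path k (≤-<-trans k≤n n<D))

zero-ldim-finite : ∀ (G : ℕ → ℕ → ℕ) → (∀ m x → G m x ≡ 0) → LdimFinite G
zero-ldim-finite G vanishes = 0 , bounded
  where
  bounded : ∀ d → HasLittlestoneTree G d → d ≤ 0
  bounded zero    _         = z≤n
  bounded (suc d) (x , tree) =
    let m , path = tree (λ _ → true) 0 z<s
    in contradiction (trans (sym (vanishes m (x []))) (path 0 z≤n)) λ ()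

-- Register machines

Regs : Set
Regs = ℕ → ℕ

update-same : ∀ (R : Regs) r v → update R r v r ≡ v
update-same R r v with r ≡ᵇ r | ≡⇒≡ᵇ r r refl
... | true | _ = refl

update-other : ∀ (R : Regs) r v {k} → k ≢ r → update R r v k ≡ R k
update-other R r v {k} k≢r with k ≡ᵇ r | ≡ᵇ⇒≡ k r
... | true  | k≡r = contradiction (k≡r tt) k≢r
... | false | _   = refl

update-cong : ∀ {R R' : Regs} r v → R ≗ R' → update R r v ≗ update R' r v
update-cong r v R≗R' k with k ≡ᵇ r
... | true  = refl
... | false = R≗R' k

update-id : ∀ (R : Regs) r → update R r (R r) ≗ R
update-id R r k with k ≟ r
... | yes refl = update-same R k (R k)
... | no k≢r   = update-other R r (R r) k≢r

update-update : ∀ (R : Regs) r v w → update (update R r v) r w ≗ update R r w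
update-update R r v w k with k ≟ r
... | yes refl = trans (update-same (update R k v) k w) (sym (update-same R k w))
... | no k≢r   = trans (update-other (update R r v) r w k≢r) (trans (update-other R r v k≢r) (sym (update-other R r w k≢r)))

AgreeBelow : ℕ → Regs → Regs → Set
AgreeBelow zero    R R' = ⊤
AgreeBelow (suc n) R R' = R 0 ≡ R' 0 × AgreeBelow n (R ∘ suc) (R' ∘ suc)

-- Register files built from updates at concrete registers agree by computation
-- on all registers above the largest one updated, so only finitely many cases remain.
≗-split : ∀ n {R R' : Regs} → AgreeBelow n R R' → (∀ k → R (n + k) ≡ R' (n + k)) → R ≗ R'
≗-split zero    _            above k       = above k
≗-split (suc n) (eq₀ , _)    above zero    = eq₀
≗-split (suc n) (_ , below)  above (suc k) = ≗-split n below above k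

run-cong : ∀ t P pc {R R' : Regs} → R ≗ R' → run t P pc R ≡ run t P pc R'
run-cong zero    P pc R≗R' = refl
run-cong (suc t) P pc {R} {R'} R≗R' with lookupInstr P pc
... | nothing = cong just (R≗R' 0)
... | just (inc r) rewrite R≗R' r = run-cong t P (suc pc) (update-cong r (suc (R' r)) R≗R')
... | just (decjz r j) with R r | R' r | R≗R' r
...   | zero  | .zero  | refl = run-cong t P j R≗R'
...   | suc v | .suc v | refl = run-cong t P (suc pc) (update-cong r v R≗R')

run-extend : ∀ {t t'} P pc R {v} → t ≤ t' → run t P pc R ≡ just v → run t' P pc R ≡ just v
run-extend {suc t} {suc t'} P pc R (s≤s t≤t') halts with lookupInstr P pc
... | nothing = halts
... | just (inc r) = run-extend P (suc pc) _ t≤t' halts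
... | just (decjz r j) with R r
...   | zero  = run-extend P j R t≤t' halts
...   | suc _ = run-extend P (suc pc) _ t≤t' halts

run-deterministic : ∀ {t t'} P pc R {v v'} → run t P pc R ≡ just v → run t' P pc R ≡ just v' → v ≡ v'
run-deterministic {t} {t'} P pc R halts halts' =
  just-injective (trans (sym (run-extend P pc R (m≤m+n t t') halts)) (run-extend P pc R (m≤n+m t' t) halts'))

Reaches : Program → ℕ → Regs → ℕ → Regs → Set
Reaches P pc R pc' R' = Σ ℕ λ s → ∀ t → run (s + t) P pc R ≡ run t P pc' R'

module _ {P : Program} where

  reaches-refl : ∀ {pc R} → Reaches P pc R pc R
  reaches-refl = 0 , λ _ → refl

  infixr 5 _⨾_
  _⨾_ : ∀ {pc R pc' R' pc'' R''} → Reaches P pc R pc' R' → Reaches P pc' R' pc'' R'' → Reaches P pc R pc'' R''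
  _⨾_ {pc} {R} (s , first) (s' , second) =
    s + s' , λ t → trans (cong (λ u → run u P pc R) (+-assoc s s' t)) (trans (first (s' + t)) (second t))

  reaches-≗ : ∀ {pc R pc' R' R''} → Reaches P pc R pc' R' → R' ≗ R'' → Reaches P pc R pc' R''
  reaches-≗ {pc' = pc'} (s , steps) R'≗R'' = s , λ t → trans (steps t) (run-cong t P pc' R'≗R'')

  reaches-agree : ∀ n {pc R pc' R' R''} → Reaches P pc R pc' R' →
                  AgreeBelow n R' R'' → (∀ k → R' (n + k) ≡ R'' (n + k)) → Reaches P pc R pc' R''
  reaches-agree n reach below above = reaches-≗ reach (≗-split n below above)

  reaches-at : ∀ {pc R pc' pc'' R'} → pc' ≡ pc'' → Reaches P pc R pc' R' → Reaches P pc R pc'' R'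
  reaches-at refl reach = reach

  reaches-from : ∀ {pc pc' R pc'' R'} → pc ≡ pc' → Reaches P pc R pc'' R' → Reaches P pc' R pc'' R'
  reaches-from refl reach = reach

  step-inc : ∀ {pc R r} → lookupInstr P pc ≡ just (inc r) → Reaches P pc R (suc pc) (update R r (suc (R r)))
  step-inc instr = 1 , λ _ → by instr
    where
    by : ∀ {pc R r t} → lookupInstr P pc ≡ just (inc r) → run (suc t) P pc R ≡ run t P (suc pc) (update R r (suc (R r)))
    by instr rewrite instr = refl

  step-jump : ∀ {pc R r j} → lookupInstr P pc ≡ just (decjz r j) → R r ≡ 0 → Reaches P pc R j R
  step-jump instr r≡0 = 1 , λ _ → by instr r≡0
    where
    by : ∀ {pc R r j t} → lookupInstr P pc ≡ just (decjz r j) → R r ≡ 0 → run (suc t) P pc R ≡ run t P j R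
    by instr r≡0 rewrite instr | r≡0 = refl

  step-dec : ∀ {pc R r j v} → lookupInstr P pc ≡ just (decjz r j) → R r ≡ suc v → Reaches P pc R (suc pc) (update R r v)
  step-dec instr nonzero = 1 , λ _ → by instr nonzero
    where
    by : ∀ {pc R r j v t} → lookupInstr P pc ≡ just (decjz r j) → R r ≡ suc v →
         run (suc t) P pc R ≡ run t P (suc pc) (update R r v)
    by instr nonzero rewrite instr | nonzero = refl

  reaches-halt : ∀ {R pc R'} → Reaches P 0 R pc R' → lookupInstr P pc ≡ nothing → Σ ℕ λ t → run t P 0 R ≡ just (R' 0)
  reaches-halt {pc = pc} {R'} (s , steps) end = s + 1 , trans (steps 1) (by end)
    where
    by : lookupInstr P pc ≡ nothing → run 1 P pc R' ≡ just (R' 0)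
    by end rewrite end = refl

data At (P : Program) : ℕ → Program → Set where
  []  : ∀ {o} → At P o []
  _∷_ : ∀ {o i b} → lookupInstr P o ≡ just i → At P (suc o) b → At P o (i ∷ b)

at-shift : ∀ {P o b} i → At P o b → At (i ∷ P) (suc o) b
at-shift i []         = []
at-shift i (e ∷ rest) = e ∷ at-shift i rest

at-self : ∀ P → At P 0 P
at-self []      = []
at-self (i ∷ P) = refl ∷ at-shift i (at-self P)

at-suffix : ∀ xs b → At (xs ++ b) (length xs) b
at-suffix []       b = at-self b
at-suffix (x ∷ xs) b = at-shift x (at-suffix xs b)

at-prefix : ∀ {P o b c} → At P o b → take (length c) b ≡ c → At P o c
at-prefix {c = []}    _         refl = []
at-prefix {c = i ∷ c} (e ∷ at) eq   rewrite sym (∷-injectiveˡ eq) = e ∷ at-prefix at (∷-injectiveʳ eq)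

within : ∀ {P o b} i {c} → At P o b → take (length c) (drop i b) ≡ c → At P (i + o) c
within         zero    at       eq = at-prefix at eq
within {P} {o} (suc i) {c} (_ ∷ at) eq = subst (λ pc → At P pc c) (+-suc i o) (within i at eq)
within {b = []} (suc i) {[]} [] refl = []

instr-within : ∀ {P o b} i {ins} → At P o b → take 1 (drop i b) ≡ ins ∷ [] → lookupInstr P (i + o) ≡ just ins
instr-within i at eq with within i at eq
... | e ∷ [] = e

at-++⁻ : ∀ {P o} b {c} → At P o (b ++ c) → At P o b × At P (length b + o) c
at-++⁻ []      at = [] , at
at-++⁻ {o = o} (i ∷ b) (e ∷ at) with at-++⁻ b at
... | atb , atc rewrite +-suc (length b) o = e ∷ atb , atc

lookup-++ : ∀ P ys {pc i} → lookupInstr P pc ≡ just i → lookupInstr (P ++ ys) pc ≡ just i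
lookup-++ (x ∷ P) ys {zero}   eq = eq
lookup-++ (x ∷ P) ys {suc pc} eq = lookup-++ P ys eq

at-++ʳ : ∀ {P o b} ys → At P o b → At (P ++ ys) o b
at-++ʳ ys []         = []
at-++ʳ {P} ys (e ∷ at) = lookup-++ P ys e ∷ at-++ʳ ys at

lookup-length : ∀ P → lookupInstr P (length P) ≡ nothing
lookup-length []      = refl
lookup-length (i ∷ P) = lookup-length P

-- Register 4 is kept at 0 throughout, so `decjz 4` is an unconditional jump.
goto : ℕ → Instr
goto j = decjz 4 j

load : ℕ → ℕ → Program
load r n = replicate n (inc r)

load-spec : ∀ {P o} r n → At P o (load r n) → ∀ R → Reaches P o R (n + o) (update R r (R r + n))
load-spec {o = o} r zero    []         R =
  reaches-≗ reaches-refl (λ k → sym (trans (cong (λ v → update R r v k) (+-identityʳ (R r))) (update-id R r k)))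
load-spec {o = o} r (suc n) (e ∷ code) R =
  reaches-at (+-suc n o)
    (step-inc e ⨾ reaches-≗ (load-spec r n code _)
                              (λ k → trans (update-update R r _ _ k) (cong (λ v → update R r v k) (one-more (R r) (update-same R r _)))))
  where
  one-more : ∀ x {y} → y ≡ suc x → y + n ≡ x + suc n
  one-more x refl = sym (+-suc x n)

load-snoc : ∀ r j T → load r j ++ inc r ∷ T ≡ inc r ∷ load r j ++ T
load-snoc r zero    T = refl
load-snoc r (suc j) T = cong (inc r ∷_) (load-snoc r j T)

clear : ℕ → ℕ → Program
clear o r = decjz r (2 + o) ∷ goto o ∷ []

clear-spec : ∀ {P o} r → r ≢ 4 → At P o (clear o r) → ∀ R → R 4 ≡ 0 → Reaches P o R (2 + o) (update R r 0)
clear-spec {P} {o} r r≢4 (test ∷ back ∷ []) R R4≡0 = loop (R r) R refl R4≡0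
  where
  loop : ∀ n R → R r ≡ n → R 4 ≡ 0 → Reaches P o R (2 + o) (update R r 0)
  loop zero    R Rr≡0 _ =
    reaches-≗ (step-jump test Rr≡0) (λ k → trans (sym (update-id R r k)) (cong (λ v → update R r v k) Rr≡0))
  loop (suc n) R Rr≡n R4≡0 =
    step-dec test Rr≡n ⨾ step-jump back R4≡0′ ⨾ reaches-≗ (loop n _ (update-same R r n) R4≡0′) (update-update R r n 0)
    where
    R4≡0′ : update R r n 4 ≡ 0
    R4≡0′ = trans (update-other R r n (λ 4≡r → r≢4 (sym 4≡r))) R4≡0

occurrences : ℕ → List ℕ → ℕ
occurrences k []       = 0
occurrences k (b ∷ bs) = if does (k ≟ b) then suc (occurrences k bs) else occurrences k bs

addTo : List ℕ → ℕ → Regs → Regs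
addTo []       v R = R
addTo (b ∷ bs) v R = addTo bs v (update R b (v + R b))

addTo-apply : ∀ bs v R k → addTo bs v R k ≡ occurrences k bs * v + R k
addTo-apply []       v R k = refl
addTo-apply (b ∷ bs) v R k rewrite addTo-apply bs v (update R b (v + R b)) k with k ≡ᵇ b | ≡ᵇ⇒≡ k b
... | true  | k≡b rewrite k≡b tt = trans (sym (+-assoc _ v (R b))) (cong (_+ R b) (+-comm _ v))
... | false | _   = refl

incs-spec : ∀ {P o} bs → At P o (map inc bs) → ∀ R → Reaches P o R (length bs + o) (addTo bs 1 R)
incs-spec         []       []          R = reaches-refl
incs-spec {o = o} (b ∷ bs) (e ∷ code) R = reaches-at (+-suc (length bs) o) (step-inc e ⨾ incs-spec bs code _)

transfer : ℕ → ℕ → List ℕ → Program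
transfer o a bs = decjz a (2 + length bs + o) ∷ map inc bs ++ goto o ∷ []

transfer-spec : ∀ {P o} a bs → a ≢ 4 → occurrences a bs ≡ 0 → occurrences 4 bs ≡ 0 →
                At P o (transfer o a bs) → ∀ R → R 4 ≡ 0 →
                Reaches P o R (2 + length bs + o) (addTo bs (R a) (update R a 0))
transfer-spec {P} {o} a bs a≢4 a∉bs 4∉bs (test ∷ body) R = loop (R a) refl
  where
  incs : At P (suc o) (map inc bs)
  incs = proj₁ (at-++⁻ (map inc bs) body)

  back : lookupInstr P (length bs + suc o) ≡ just (goto o)
  back with proj₂ (at-++⁻ (map inc bs) body)
  ... | instr ∷ [] rewrite length-map inc bs = instr

  emptied : ∀ R → R a ≡ 0 → R ≗ addTo bs 0 (update R a 0)
  emptied R Ra≡0 k rewrite addTo-apply bs 0 (update R a 0) k | *-zeroʳ (occurrences k bs) with k ≟ a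
  ... | yes refl = trans Ra≡0 (sym (update-same R k 0))
  ... | no k≢a   = sym (update-other R a 0 k≢a)

  moved : ∀ R n → addTo bs n (update (addTo bs 1 (update R a n)) a 0) ≗ addTo bs (suc n) (update R a 0)
  moved R n k rewrite addTo-apply bs n (update (addTo bs 1 (update R a n)) a 0) k
                    | addTo-apply bs (suc n) (update R a 0) k with k ≟ a
  ... | yes refl rewrite a∉bs | update-same (addTo bs 1 (update R k n)) k 0 | update-same R k 0 = refl
  ... | no k≢a
    rewrite update-other (addTo bs 1 (update R a n)) a 0 k≢a | addTo-apply bs 1 (update R a n) k
          | update-other R a n k≢a | update-other R a 0 k≢a | *-suc (occurrences k bs) n | *-identityʳ (occurrences k bs)
          = trans (sym (+-assoc (c * n) c (R k))) (cong (_+ R k) (+-comm (c * n) c))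
    where
    c : ℕ
    c = occurrences k bs

  loop : ∀ n {R} → R a ≡ n → R 4 ≡ 0 → Reaches P o R (2 + length bs + o) (addTo bs n (update R a 0))
  loop zero    {R} Ra≡0 _ = reaches-≗ (step-jump test Ra≡0) (emptied R Ra≡0)
  loop (suc n) {R} Ra≡sn R4≡0 =
    step-dec test Ra≡sn ⨾ incs-spec bs incs _ ⨾ step-jump back S4≡0 ⨾ reaches-≗ (loop n Sa≡n S4≡0) (moved R n)
    where
    S : Regs
    S = addTo bs 1 (update R a n)
    Sa≡n : S a ≡ n
    Sa≡n = trans (addTo-apply bs 1 (update R a n) a) (trans (cong (λ c → c * 1 + _) a∉bs) (update-same R a n))
    S4≡0 : S 4 ≡ 0
    S4≡0 = trans (addTo-apply bs 1 (update R a n) 4)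
                 (trans (cong (λ c → c * 1 + _) 4∉bs) (trans (update-other R a n (λ 4≡a → a≢4 (sym 4≡a))) R4≡0))

-- Cantor pairing and Gödel numbering

triangle : ℕ → ℕ
triangle zero    = 0
triangle (suc s) = suc s + triangle s

pair : ℕ → ℕ → ℕ
pair a b = triangle (a + b) + b

consCode : ℕ → ℕ → ℕ
consCode h t = suc (pair h t)

unpair-triangle : ∀ s → unpair (triangle s) ≡ (s , 0)
unpair-diagonal : ∀ s j → j ≤ s → unpair (triangle s + j) ≡ (s ∸ j , j)
unpair-triangle zero    = refl
unpair-triangle (suc s) rewrite +-comm s (triangle s) | unpair-diagonal s s ≤-refl | n∸n≡0 s = refl
unpair-diagonal s zero    _   rewrite +-identityʳ (triangle s) = unpair-triangle s
unpair-diagonal s (suc j) j<s rewrite +-suc (triangle s) j | unpair-diagonal s j (<⇒≤ j<s) | +-∸-assoc 1 j<s = refl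

unpair-pair : ∀ a b → unpair (pair a b) ≡ (a , b)
unpair-pair a b rewrite unpair-diagonal (a + b) b (m≤n+m b a) | m+n∸n≡m a b = refl

unpair-iterate : ∀ n → iterate nextPair (0 , 0) n ≡ unpair n
unpair-iterate n = trans (sym (iterate-is-fold (0 , 0) nextPair n)) (unpair-fold n)
  where
  unpair-fold : ∀ n → fold (0 , 0) nextPair n ≡ unpair n
  unpair-fold zero    = refl
  unpair-fold (suc n) = cong nextPair (unpair-fold n)

encodeInstr : Instr → ℕ
encodeInstr (inc r)     = pair 0 r
encodeInstr (decjz r j) = pair 1 (pair r j)

encodeProg : Program → ℕ
encodeProg []      = 0
encodeProg (i ∷ p) = consCode (encodeInstr i) (encodeProg p)

decodeInstr-encodeInstr : ∀ i → decodeInstr (encodeInstr i) ≡ i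
decodeInstr-encodeInstr (inc r)     rewrite unpair-pair 0 r = refl
decodeInstr-encodeInstr (decjz r j) rewrite unpair-pair 1 (pair r j) | unpair-pair r j = refl

-- The fuel of decodeProg only has to exceed the code, and the tail of a code is smaller than the code.
decodeProg-encodeProg : ∀ f p → encodeProg p ≤ f → decodeProg f (encodeProg p) ≡ p
decodeProg-encodeProg zero    []      _         = refl
decodeProg-encodeProg (suc f) []      _         = refl
decodeProg-encodeProg (suc f) (i ∷ p) (s≤s p≤f)
  rewrite unpair-pair (encodeInstr i) (encodeProg p) | decodeInstr-encodeInstr i
        | decodeProg-encodeProg f p (≤-trans (m≤n+m (encodeProg p) _) p≤f) = refl

decode-encode : ∀ p → decode (encodeProg p) ≡ p
decode-encode p = decodeProg-encodeProg (encodeProg p) p ≤-refl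

push : ℕ → Program
push o = transfer o 7 (8 ∷ []) ++ transfer (3 + o) 6 (8 ∷ 9 ∷ []) ++ transfer (7 + o) 9 (6 ∷ []) ++
         decjz 8 (20 + o) ∷ inc 6 ∷ transfer (12 + o) 8 (6 ∷ 10 ∷ []) ++ transfer (16 + o) 10 (8 ∷ []) ++
         goto (10 + o) ∷ inc 6 ∷ []

triangle-loop : ∀ {P o} → At P o (push o) → ∀ j R → R 8 ≡ j → R 10 ≡ 0 → R 4 ≡ 0 →
                Reaches P (10 + o) R (20 + o) (update (update R 8 0) 6 (triangle j + R 6))
triangle-loop {P} {o} code = loop
  where
  test : lookupInstr P (10 + o) ≡ just (decjz 8 (20 + o))
  test = instr-within 10 code refl
  loop : ∀ j R → R 8 ≡ j → R 10 ≡ 0 → R 4 ≡ 0 → Reaches P (10 + o) R (20 + o) (update (update R 8 0) 6 (triangle j + R 6))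
  loop zero    R R8≡0 _ _ =
    reaches-agree 9 (step-jump test R8≡0) (refl , refl , refl , refl , refl , refl , refl , refl , R8≡0 , tt) (λ _ → refl)
  loop (suc j) R R8≡sj R10≡0 R4≡0 =
    step-dec test R8≡sj ⨾ step-inc (instr-within 11 code refl) ⨾
    transfer-spec 8 (6 ∷ 10 ∷ []) (λ ()) refl refl (within 12 code refl) _ R4≡0 ⨾
    transfer-spec 10 (8 ∷ []) (λ ()) refl refl (within 16 code refl) _ R4≡0 ⨾
    step-jump (instr-within 19 code refl) R4≡0 ⨾
    reaches-agree 11 (loop j _ counter refl R4≡0)
      (refl , refl , refl , refl , refl , refl , accumulated , refl , refl , refl , sym R10≡0 , tt) (λ _ → refl)
    where
    counter : j + R 10 + 0 ≡ j
    counter = trans (+-identityʳ _) (trans (cong (j +_) R10≡0) (+-identityʳ j))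
    accumulated : triangle j + (j + suc (R 6)) ≡ triangle (suc j) + R 6
    accumulated = arithmetic (triangle j) j (R 6)
      where
      arithmetic : ∀ t j x → t + (j + suc x) ≡ suc j + t + x
      arithmetic = solve-∀

push-spec : ∀ {P o} → At P o (push o) → ∀ R → R 8 ≡ 0 → R 9 ≡ 0 → R 10 ≡ 0 → R 4 ≡ 0 →
            Reaches P o R (21 + o) (update (update R 7 0) 6 (consCode (R 7) (R 6)))
push-spec code R R8≡0 R9≡0 R10≡0 R4≡0 =
  transfer-spec 7 (8 ∷ []) (λ ()) refl refl (within 0 code refl) R R4≡0 ⨾
  transfer-spec 6 (8 ∷ 9 ∷ []) (λ ()) refl refl (within 3 code refl) _ R4≡0 ⨾
  transfer-spec 9 (6 ∷ []) (λ ()) refl refl (within 7 code refl) _ R4≡0 ⨾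
  triangle-loop code _ _ refl R10≡0 R4≡0 ⨾
  reaches-agree 11 (step-inc (instr-within 20 code refl))
    (refl , refl , refl , refl , refl , refl , encoded , refl , sym R8≡0 , sym R9≡0 , refl , tt) (λ _ → refl)
  where
  encoded : suc (triangle (R 6 + (R 7 + R 8)) + (R 6 + R 9 + 0)) ≡ consCode (R 7) (R 6)
  encoded rewrite R8≡0 | R9≡0 | +-identityʳ (R 7) | +-identityʳ (R 6) | +-identityʳ (R 6) | +-comm (R 6) (R 7) = refl

iteratePairs : ℕ → Program
iteratePairs o = decjz 12 (9 + o) ∷ decjz 7 (4 + o) ∷ inc 13 ∷ goto o ∷
                 inc 13 ∷ transfer (5 + o) 13 (7 ∷ []) ++ goto o ∷ []

withPair : Regs → ℕ × ℕ → Regs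
withPair R p = update (update (update R 12 0) 7 (proj₁ p)) 13 (proj₂ p)

iteratePairs-spec : ∀ {P o} → At P o (iteratePairs o) → ∀ n R → R 12 ≡ n → R 4 ≡ 0 →
                    Reaches P o R (9 + o) (withPair R (iterate nextPair (R 7 , R 13) n))
iteratePairs-spec {P} {o} code = loop
  where
  test : lookupInstr P o ≡ just (decjz 12 (9 + o))
  test = instr-within 0 code refl
  loop : ∀ n R → R 12 ≡ n → R 4 ≡ 0 → Reaches P o R (9 + o) (withPair R (iterate nextPair (R 7 , R 13) n))
  loop zero R R12≡0 _ =
    reaches-agree 14 (step-jump test R12≡0)
      (refl , refl , refl , refl , refl , refl , refl , refl , refl , refl , refl , refl , R12≡0 , refl , tt) (λ _ → refl)
  loop (suc n) R R12≡sn R4≡0 with R 7 in R7≡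
  ... | suc a =
    step-dec test R12≡sn ⨾ step-dec (instr-within 1 code refl) R7≡ ⨾ step-inc (instr-within 2 code refl) ⨾
    step-jump (instr-within 3 code refl) R4≡0 ⨾
    reaches-agree 14 (loop n _ refl R4≡0)
      (refl , refl , refl , refl , refl , refl , refl , refl , refl , refl , refl , refl , refl , refl , tt) (λ _ → refl)
  ... | zero =
    step-dec test R12≡sn ⨾ step-jump (instr-within 1 code refl) R7≡ ⨾ step-inc (instr-within 4 code refl) ⨾
    transfer-spec 13 (7 ∷ []) (λ ()) refl refl (within 5 code refl) _ R4≡0 ⨾
    step-jump (instr-within 8 code refl) R4≡0 ⨾
    reaches-agree 14 (loop n _ refl R4≡0)
      (refl , refl , refl , refl , refl , refl , refl , after proj₁ , refl , refl , refl , refl , refl , after proj₂ , tt) (λ _ → refl)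
    where
    after : (f : ℕ × ℕ → ℕ) → f (iterate nextPair (suc (R 13) + R 7 , 0) n) ≡ f (iterate nextPair (suc (R 13) , 0) n)
    after f = cong (λ h → f (iterate nextPair (h , 0) n)) (trans (cong (suc (R 13) +_) R7≡) (+-identityʳ _))

-- Clocked simulation of a fixed program

-- Register r of the guest lives in register 15 + r of the host, register 5 holds the fuel.
-- Guest instruction i occupies host slots 2 i (fuel check) and 2 i + 1, and every guest jump
-- past the end of the guest is redirected to slot 2 · length of guest, the exit.
guestInstr : ℕ → ℕ → Instr → Instr
guestInstr o L (inc r)     = inc (15 + r)
guestInstr o L (decjz r j) = decjz (15 + r) (2 * (j ⊓ L) + o)

clockedBody : ℕ → ℕ → ℕ → Program → Program
clockedBody o L timeout []      = []
clockedBody o L timeout (i ∷ D) = decjz 5 timeout ∷ guestInstr o L i ∷ clockedBody o L timeout D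

clocked : ℕ → ℕ → ℕ → Program → Program
clocked o halt timeout D = clockedBody o (length D) timeout D ++ goto halt ∷ []

length-clockedBody : ∀ o L timeout D → length (clockedBody o L timeout D) ≡ 2 * length D
length-clockedBody o L timeout []      = refl
length-clockedBody o L timeout (i ∷ D) rewrite length-clockedBody o L timeout D | +-suc (length D) (length D + 0) = refl

clockedBody-slots : ∀ {P o'} o L timeout D → At P o' (clockedBody o L timeout D) → ∀ {pc ins} → lookupInstr D pc ≡ just ins →
                    lookupInstr P (2 * pc + o') ≡ just (decjz 5 timeout) ×
                    lookupInstr P (suc (2 * pc + o')) ≡ just (guestInstr o L ins)
clockedBody-slots o L timeout (i ∷ D) (check ∷ instr ∷ _) {zero} refl = check , instr
clockedBody-slots {P} {o'} o L timeout (i ∷ D) (_ ∷ _ ∷ code) {suc pc} {ins} eq =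
  subst (λ n → lookupInstr P n ≡ just (decjz 5 timeout) × lookupInstr P (suc n) ≡ just (guestInstr o L ins))
        (two-slots pc o') (clockedBody-slots o L timeout D code eq)
  where
  two-slots : ∀ pc o' → 2 * pc + suc (suc o') ≡ 2 * suc pc + o'
  two-slots = solve-∀

lookup-nothing : ∀ (D : Program) {pc} → lookupInstr D pc ≡ nothing → length D ≤ pc
lookup-nothing []      _  = z≤n
lookup-nothing (i ∷ D) {zero} ()
lookup-nothing (i ∷ D) {suc pc} eq = s≤s (lookup-nothing D eq)

lookup-just : ∀ (D : Program) {pc ins} → lookupInstr D pc ≡ just ins → pc < length D
lookup-just (i ∷ D) {zero}   _  = s≤s z≤n
lookup-just (i ∷ D) {suc pc} eq = s≤s (lookup-just D eq)

Embeds : Regs → Regs → Set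
Embeds S R = ∀ r → S (15 + r) ≡ R r

embeds-update : ∀ {S R} → Embeds S R → ∀ r {v w} → v ≡ w → Embeds (update S (15 + r) v) (update R r w)
embeds-update embeds r v≡w x with x ≡ᵇ r
... | true  = v≡w
... | false = embeds x

Unchanged : Regs → Regs → Set
Unchanged S' S = ∀ r → T (r <ᵇ 15) → r ≢ 5 → S' r ≡ S r

unchanged-fuel : ∀ S c → Unchanged (update S 5 c) S
unchanged-fuel S c r _ r≢5 = update-other S 5 c r≢5

unchanged-guest : ∀ {S' S} r v → Unchanged S' S → Unchanged (update S' (15 + r) v) S
unchanged-guest {S'} r v unchanged r' r'<15 r'≢5 =
  trans (update-other S' (15 + r) v (λ { refl → <⇒≱ (<ᵇ⇒< r' 15 r'<15) (m≤m+n 15 r) })) (unchanged r' r'<15 r'≢5)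

unchanged-trans : ∀ {S'' S' S} → Unchanged S'' S' → Unchanged S' S → Unchanged S'' S
unchanged-trans later earlier r r<15 r≢5 = trans (later r r<15 r≢5) (earlier r r<15 r≢5)

module Simulation (P D : Program) (o halt timeout : ℕ) (code : At P o (clocked o halt timeout D)) where

  slot : ℕ → ℕ
  slot pc = 2 * (pc ⊓ length D) + o

  data Outcome (pc : ℕ) (S : Regs) : Maybe ℕ → Set where
    halted  : ∀ {w} S' → Reaches P (slot pc) S halt S' → Unchanged S' S → S' 15 ≡ w → Outcome pc S (just w)
    ranOut  : ∀ S' → Reaches P (slot pc) S timeout S' → Unchanged S' S → Outcome pc S nothing

  at-body : At P o (clockedBody o (length D) timeout D)
  at-body = proj₁ (at-++⁻ (clockedBody o (length D) timeout D) code)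

  exit-instr : lookupInstr P (2 * length D + o) ≡ just (goto halt)
  exit-instr with proj₂ (at-++⁻ (clockedBody o (length D) timeout D) code)
  ... | instr ∷ [] rewrite length-clockedBody o (length D) timeout D = instr

  guest-slots : ∀ {pc ins} → lookupInstr D pc ≡ just ins →
                lookupInstr P (2 * pc + o) ≡ just (decjz 5 timeout) ×
                lookupInstr P (suc (2 * pc + o)) ≡ just (guestInstr o (length D) ins)
  guest-slots = clockedBody-slots o (length D) timeout D at-body

  slot-running : ∀ {pc} → pc < length D → slot pc ≡ 2 * pc + o
  slot-running pc<L rewrite m≤n⇒m⊓n≡m (<⇒≤ pc<L) = refl

  slot-next : ∀ {pc} → pc < length D → 2 + (2 * pc + o) ≡ slot (suc pc)
  slot-next {pc} pc<L rewrite m≤n⇒m⊓n≡m pc<L | +-suc pc (pc + 0) = refl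

  slot-exit : ∀ {pc} → length D ≤ pc → slot pc ≡ 2 * length D + o
  slot-exit L≤pc rewrite m≥n⇒m⊓n≡n L≤pc = refl

  from-slot : ∀ {pc ins S pc' S'} → lookupInstr D pc ≡ just ins → Reaches P (2 * pc + o) S pc' S' → Reaches P (slot pc) S pc' S'
  from-slot eq = reaches-from (sym (slot-running (lookup-just D eq)))

  extend : ∀ {pc pc' S S' m} → Reaches P (slot pc) S (slot pc') S' → Unchanged S' S → Outcome pc' S' m → Outcome pc S m
  extend reach unchanged (halted S'' reach' unchanged' out) = halted S'' (reach ⨾ reach') (unchanged-trans unchanged' unchanged) out
  extend reach unchanged (ranOut S'' reach' unchanged')     = ranOut S'' (reach ⨾ reach') (unchanged-trans unchanged' unchanged)

  finished : ∀ {pc R S} → lookupInstr D pc ≡ nothing → Embeds S R → S 4 ≡ 0 → Outcome pc S (just (R 0))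
  finished eq embeds S4≡0 =
    halted _ (reaches-from (sym (slot-exit (lookup-nothing D eq))) (step-jump exit-instr S4≡0)) (λ _ _ _ → refl) (embeds 0)

  starved : ∀ {pc S ins} → lookupInstr D pc ≡ just ins → S 5 ≡ 0 → S 4 ≡ 0 → Outcome pc S nothing
  starved eq S5≡0 S4≡0 =
    ranOut _ (from-slot eq (step-jump (proj₁ (guest-slots eq)) S5≡0)) (λ _ _ _ → refl)

  -- The guest halts with output w within c + 1 steps iff the host reaches `halt` with w in register 15.
  simulate : ∀ c pc R S → Embeds S R → S 5 ≡ c → S 4 ≡ 0 → Outcome pc S (run (suc c) D pc R)
  simulate zero pc R S embeds fuel S4≡0 with lookupInstr D pc in eq
  ... | nothing          = finished eq embeds S4≡0
  ... | just (inc r)     = starved eq fuel S4≡0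
  ... | just (decjz r j) with R r
  ...   | zero  = starved eq fuel S4≡0
  ...   | suc _ = starved eq fuel S4≡0
  simulate (suc c) pc R S embeds fuel S4≡0 with lookupInstr D pc in eq
  ... | nothing          = finished eq embeds S4≡0
  ... | just (inc r) with guest-slots eq
  ...   | check , instr =
    extend (from-slot eq (step-dec check fuel ⨾ reaches-at (slot-next (lookup-just D eq)) (step-inc instr)))
           (unchanged-guest r _ (unchanged-fuel S c))
           (simulate c (suc pc) _ _ (embeds-update {update S 5 c} embeds r (cong suc (embeds r))) refl S4≡0)
  simulate (suc c) pc R S embeds fuel S4≡0 | just (decjz r j) with guest-slots eq | R r in Rr
  ...   | check , instr | zero =
    extend (from-slot eq (step-dec check fuel ⨾ step-jump instr (trans (embeds r) Rr)))
           (unchanged-fuel S c)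
           (simulate c j R _ embeds refl S4≡0)
  ...   | check , instr | suc v =
    extend (from-slot eq (step-dec check fuel ⨾ reaches-at (slot-next (lookup-just D eq)) (step-dec instr (trans (embeds r) Rr))))
           (unchanged-guest r _ (unchanged-fuel S c))
           (simulate c (suc pc) _ _ (embeds-update {update S 5 c} embeds r refl) refl S4≡0)

-- The diagonal class

-- Hypothesis m of the diagonal class takes at point n the value verdict (run (n + 1) steps of d on e) m n.
verdict : Maybe ℕ → ℕ → ℕ → ℕ
verdict (just 1) m n = threshold m n
verdict _        m n = 0

verdict≤1 : ∀ res m n → verdict res m n ≤ 1
verdict≤1 nothing              m n = z≤n
verdict≤1 (just zero)          m n = z≤n
verdict≤1 (just (suc zero))    m n = bit≤1 (n <ᵇ m)
verdict≤1 (just (suc (suc w))) m n = z≤n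

verdict-≢1 : ∀ res m n → res ≢ just 1 → verdict res m n ≡ 0
verdict-≢1 nothing              m n _   = refl
verdict-≢1 (just zero)          m n _   = refl
verdict-≢1 (just (suc zero))    m n ≢1 = contradiction refl ≢1
verdict-≢1 (just (suc (suc w))) m n _   = refl

module Diagonal (D : Program) where

  simulator : Program
  simulator = clocked 212 195 207 D

  tailStart : ℕ
  tailStart = 212 + length simulator

  -- Registers: 0 and 1 hold the input (m, n), and 0 the output; the tail adds k to 2 and reads 3
  -- to decide whether to return or halt; 6 accumulates a code, 7 is the entry pushed onto it and
  -- 8–10 are scratch; 11–13 are loop counters and 14 holds copies; 5 and 15, 16, … are the fuel
  -- and the registers of d. The right column gives the address of each line.
  prelude : Program
  prelude =
    goto tailStart ∷                                     --   0
    load 7 (encodeInstr (decjz 3 1)) ++                  --   1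
    push 90 ++                                           --  90
    transfer 111 2 (11 ∷ 14 ∷ []) ++                     -- 111
    transfer 115 14 (2 ∷ []) ++                          -- 115
    decjz 11 146 ∷                                       -- 118
    load 7 (encodeInstr (inc 2)) ++                      -- 119
    push 124 ++                                          -- 124
    goto 118 ∷                                           -- 145
    transfer 146 2 (12 ∷ []) ++                          -- 146
    decjz 12 184 ∷                                       -- 149
    iteratePairs 150 ++                                  -- 150
    push 159 ++                                          -- 159
    transfer 180 13 (12 ∷ []) ++                         -- 180
    goto 149 ∷                                           -- 183
    transfer 184 6 (15 ∷ []) ++                          -- 184
    transfer 187 1 (5 ∷ 14 ∷ []) ++                      -- 187
    transfer 191 14 (1 ∷ []) ++                          -- 191
    goto 212 ∷                                           -- 194
    decjz 15 207 ∷ decjz 15 198 ∷ goto 207 ∷             -- 195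
    decjz 1 201 ∷ decjz 0 206 ∷ goto 198 ∷               -- 198
    decjz 0 206 ∷                                        -- 201
    clear 202 0 ++                                       -- 202
    inc 0 ∷ goto 210 ∷                                   -- 204
    goto 210 ∷                                           -- 206
    clear 207 0 ++                                       -- 207
    goto 210 ∷                                           -- 209
    inc 3 ∷ goto tailStart ∷ []                          -- 210

  body : Program
  body = prelude ++ simulator

  -- k and selfCode are huge numerals; being abstract, they are never evaluated by the typechecker.
  abstract
    k : ℕ
    k = encodeProg (reverse body)

    k-def : k ≡ encodeProg (reverse body)
    k-def = refl

  tailCode : Program
  tailCode = load 2 k ++ decjz 3 1 ∷ []

  Q : Program
  Q = body ++ tailCode

  abstract
    selfCode : ℕ
    selfCode = encodeProg Q

    selfCode-def : selfCode ≡ encodeProg Q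
    selfCode-def = refl

  length-body : length body ≡ tailStart
  length-body = length-++ prelude {simulator}

  at-simulator : At Q 212 simulator
  at-simulator = at-++ʳ {body} {length prelude} tailCode (at-suffix prelude simulator)

  at-tail : At Q tailStart tailCode
  at-tail = subst (λ o → At Q o tailCode) length-body (at-suffix body tailCode)

  at-reload : At Q tailStart (load 2 k)
  at-reload = proj₁ (at-++⁻ (load 2 k) at-tail)

  tail-test : lookupInstr Q (k + tailStart) ≡ just (decjz 3 1)
  tail-test with proj₂ (at-++⁻ (load 2 k) at-tail)
  ... | instr ∷ [] rewrite length-replicate k {inc 2} = instr

  length-Q : length Q ≡ suc (k + tailStart)
  length-Q = trans (length-++ body {tailCode}) (trans (cong₂ _+_ length-body (length-++ (load 2 k) {decjz 3 1 ∷ []}))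
                   (trans (cong (λ l → tailStart + (l + 1)) (length-replicate k)) (arithmetic tailStart k)))
    where
    arithmetic : ∀ t k → t + (k + 1) ≡ suc (k + t)
    arithmetic = solve-∀

  at-prelude : At Q 0 prelude
  at-prelude = at-++ʳ tailCode (at-++ʳ simulator (at-suffix [] prelude))

  code-at : ∀ o {b} → take (length b) (drop o prelude) ≡ b → At Q o b
  code-at o {b} eq = subst (λ o' → At Q o' b) (+-identityʳ o) (within o at-prelude eq)

  read-k : ∀ R → R 3 ≡ 0 → R 4 ≡ 0 → Reaches Q 0 R 1 (update R 2 (R 2 + k))
  read-k R R3≡0 R4≡0 = step-jump refl R4≡0 ⨾ load-spec 2 k at-reload R ⨾ step-jump tail-test R3≡0

  prepend-loads : ∀ T j R → R 11 ≡ j → R 6 ≡ encodeProg T → R 7 ≡ 0 → R 8 ≡ 0 → R 9 ≡ 0 → R 10 ≡ 0 → R 4 ≡ 0 →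
                  Reaches Q 118 R 146 (update (update R 11 0) 6 (encodeProg (load 2 j ++ T)))
  prepend-loads T zero R R11≡0 R6≡T _ _ _ _ _ =
    reaches-agree 12 (step-jump refl R11≡0)
      (refl , refl , refl , refl , refl , refl , R6≡T , refl , refl , refl , refl , R11≡0 , tt) (λ _ → refl)
  prepend-loads T (suc j) R R11≡sj R6≡T R7≡0 R8≡0 R9≡0 R10≡0 R4≡0 =
    step-dec refl R11≡sj ⨾ load-spec 7 (encodeInstr (inc 2)) (code-at 119 refl) _ ⨾
    push-spec (code-at 124 refl) _ R8≡0 R9≡0 R10≡0 R4≡0 ⨾ step-jump refl R4≡0 ⨾
    reaches-agree 12 (prepend-loads (inc 2 ∷ T) j _ refl pushed refl R8≡0 R9≡0 R10≡0 R4≡0)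
      (refl , refl , refl , refl , refl , refl , cong encodeProg (load-snoc 2 j T) , sym R7≡0 , refl , refl , refl , refl , tt)
      (λ _ → refl)
    where
    pushed : consCode (R 7 + encodeInstr (inc 2)) (R 6) ≡ encodeProg (inc 2 ∷ T)
    pushed = cong₂ consCode (cong (_+ encodeInstr (inc 2)) R7≡0) R6≡T

  prepend-reversed : ∀ L A R → R 12 ≡ encodeProg L → R 6 ≡ encodeProg A → R 7 ≡ 0 → R 13 ≡ 0 →
                     R 8 ≡ 0 → R 9 ≡ 0 → R 10 ≡ 0 → R 4 ≡ 0 →
                     Reaches Q 149 R 184 (update (update R 12 0) 6 (encodeProg (L ʳ++ A)))
  prepend-reversed [] A R R12≡0 R6≡A _ _ _ _ _ _ =
    reaches-agree 13 (step-jump refl R12≡0)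
      (refl , refl , refl , refl , refl , refl , R6≡A , refl , refl , refl , refl , refl , R12≡0 , tt) (λ _ → refl)
  prepend-reversed (i ∷ L) A R R12≡iL R6≡A R7≡0 R13≡0 R8≡0 R9≡0 R10≡0 R4≡0 =
    step-dec refl R12≡iL ⨾ iteratePairs-spec (code-at 150 refl) (pair (encodeInstr i) (encodeProg L)) _ refl R4≡0 ⨾
    push-spec (code-at 159 refl) _ R8≡0 R9≡0 R10≡0 R4≡0 ⨾
    transfer-spec 13 (12 ∷ []) (λ ()) refl refl (code-at 180 refl) _ R4≡0 ⨾ step-jump refl R4≡0 ⨾
    reaches-agree 14 (prepend-reversed L (i ∷ A) _ (trans (+-identityʳ _) (cong proj₂ unpacked))
                                             (cong₂ consCode (cong proj₁ unpacked) R6≡A) refl refl R8≡0 R9≡0 R10≡0 R4≡0)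
      (refl , refl , refl , refl , refl , refl , refl , sym R7≡0 , refl , refl , refl , refl , refl , sym R13≡0 , tt)
      (λ _ → refl)
    where
    unpacked : iterate nextPair (R 7 , R 13) (pair (encodeInstr i) (encodeProg L)) ≡ (encodeInstr i , encodeProg L)
    unpacked rewrite R7≡0 | R13≡0 = trans (unpair-iterate (pair (encodeInstr i) (encodeProg L))) (unpair-pair _ _)

  Answers : ℕ → Regs → ℕ → Set
  Answers pc S v = Σ Regs λ S' → Reaches Q pc S 210 S' × S' 0 ≡ v × S' 3 ≡ 0 × S' 4 ≡ 0

  answers-after : ∀ {pc R pc' S v} → Reaches Q pc R pc' S → Answers pc' S v → Answers pc R v
  answers-after reach (S' , reach' , out) = S' , reach ⨾ reach' , out

  reject : ∀ S → S 3 ≡ 0 → S 4 ≡ 0 → Answers 207 S 0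
  reject S S3≡0 S4≡0 = _ , clear-spec 0 (λ ()) (code-at 207 refl) S S4≡0 ⨾ step-jump refl S4≡0 , refl , S3≡0 , S4≡0

  threshold-answer : ∀ m n S → S 0 ≡ m → S 1 ≡ n → S 3 ≡ 0 → S 4 ≡ 0 → Answers 198 S (threshold m n)
  threshold-answer zero    zero    S S0≡0  S1≡0  S3≡0 S4≡0 =
    S , step-jump refl S1≡0 ⨾ step-jump refl S0≡0 ⨾ step-jump refl S4≡0 , S0≡0 , S3≡0 , S4≡0
  threshold-answer (suc m) zero    S S0≡sm S1≡0  S3≡0 S4≡0 =
    _ , step-jump refl S1≡0 ⨾ step-dec refl S0≡sm ⨾ clear-spec 0 (λ ()) (code-at 202 refl) _ S4≡0 ⨾
        step-inc refl ⨾ step-jump refl S4≡0 ,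
    refl , S3≡0 , S4≡0
  threshold-answer zero    (suc n) S S0≡0  S1≡sn S3≡0 S4≡0 =
    _ , step-dec refl S1≡sn ⨾ step-jump refl S0≡0 ⨾ step-jump refl S4≡0 , S0≡0 , S3≡0 , S4≡0
  threshold-answer (suc m) (suc n) S S0≡sm S1≡sn S3≡0 S4≡0 =
    answers-after (step-dec refl S1≡sn ⨾ step-dec refl S0≡sm ⨾ step-jump refl S4≡0)
                  (threshold-answer m n _ refl refl S3≡0 S4≡0)

  report : ∀ w S → S 15 ≡ w → S 3 ≡ 0 → S 4 ≡ 0 → Answers 195 S (verdict (just w) (S 0) (S 1))
  report zero          S S15≡0 S3≡0 S4≡0 = answers-after (step-jump refl S15≡0) (reject S S3≡0 S4≡0)
  report (suc zero)    S S15≡1 S3≡0 S4≡0 =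
    answers-after (step-dec refl S15≡1 ⨾ step-jump refl refl) (threshold-answer (S 0) (S 1) _ refl refl S3≡0 S4≡0)
  report (suc (suc w)) S S15≡w S3≡0 S4≡0 =
    answers-after (step-dec refl S15≡w ⨾ step-dec refl refl ⨾ step-jump refl S4≡0) (reject _ S3≡0 S4≡0)

  finish : ∀ S → S 3 ≡ 0 → S 4 ≡ 0 →
           Reaches Q 210 S (suc (k + tailStart)) (update (update (update S 3 (suc (S 3))) 2 (S 2 + k)) 3 0)
  finish S S3≡0 S4≡0 = step-inc refl ⨾ step-jump refl S4≡0 ⨾ load-spec 2 k at-reload _ ⨾ step-dec tail-test (cong suc S3≡0)

  halts-with : ∀ {R v} → Answers 0 R v → Σ ℕ λ t → run t Q 0 R ≡ just v
  halts-with (S , reach , S0≡v , S3≡0 , S4≡0) =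
    let t , halts = reaches-halt (reach ⨾ finish S S3≡0 S4≡0) end in t , trans halts (cong just S0≡v)
    where
    end : lookupInstr Q (suc (k + tailStart)) ≡ nothing
    end = subst (λ pc → lookupInstr Q pc ≡ nothing) length-Q (lookup-length Q)

  Input : ℕ → ℕ → Regs
  Input m n = initRegs (m ∷ n ∷ [])

  GuestInput : Regs
  GuestInput = initRegs (selfCode ∷ [])

  self-reproduced : encodeProg (reverse body ʳ++ tailCode) ≡ selfCode
  self-reproduced = trans (cong encodeProg (trans (ʳ++-defn (reverse body)) (cong (_++ tailCode) (reverse-involutive body))))
                          (sym selfCode-def)

  prepare : ∀ m n → Σ Regs λ S → Reaches Q 0 (Input m n) 212 S ×
            Embeds S GuestInput × S 5 ≡ n × S 0 ≡ m × S 1 ≡ n × S 3 ≡ 0 × S 4 ≡ 0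
  prepare m n =
    _ , read-k (Input m n) refl refl ⨾
        load-spec 7 (encodeInstr (decjz 3 1)) (code-at 1 refl) _ ⨾ push-spec (code-at 90 refl) _ refl refl refl refl ⨾
        transfer-spec 2 (11 ∷ 14 ∷ []) (λ ()) refl refl (code-at 111 refl) _ refl ⨾
        transfer-spec 14 (2 ∷ []) (λ ()) refl refl (code-at 115 refl) _ refl ⨾
        prepend-loads (decjz 3 1 ∷ []) k _ (+-identityʳ k) refl refl refl refl refl refl ⨾
        transfer-spec 2 (12 ∷ []) (λ ()) refl refl (code-at 146 refl) _ refl ⨾
        prepend-reversed (reverse body) tailCode _ code-of-body refl refl refl refl refl refl refl ⨾
        transfer-spec 6 (15 ∷ []) (λ ()) refl refl (code-at 184 refl) _ refl ⨾
        transfer-spec 1 (5 ∷ 14 ∷ []) (λ ()) refl refl (code-at 187 refl) _ refl ⨾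
        transfer-spec 14 (1 ∷ []) (λ ()) refl refl (code-at 191 refl) _ refl ⨾
        step-jump refl refl ,
      (λ { zero → trans (+-identityʳ _) self-reproduced ; (suc r) → refl }) ,
      +-identityʳ n , refl , trans (+-identityʳ _) (+-identityʳ n) , refl , refl
    where
    code-of-body : k + 0 + 0 + 0 ≡ encodeProg (reverse body)
    code-of-body = trans (+-identityʳ _) (trans (+-identityʳ _) (trans (+-identityʳ k) k-def))

  open Simulation Q D 212 195 207 at-simulator using (Outcome; halted; ranOut; simulate)

  conclude : ∀ m n {res} S → S 0 ≡ m → S 1 ≡ n → S 3 ≡ 0 → S 4 ≡ 0 → Outcome 0 S res → Answers 212 S (verdict res m n)
  conclude m n S S0≡m S1≡n S3≡0 S4≡0 (halted {w} S' reach unchanged out) =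
    answers-after reach (subst₂ (λ a b → Answers 195 S' (verdict (just w) a b))
                                (trans (unchanged 0 _ (λ ())) S0≡m) (trans (unchanged 1 _ (λ ())) S1≡n)
                                (report w S' out (trans (unchanged 3 _ (λ ())) S3≡0) (trans (unchanged 4 _ (λ ())) S4≡0)))
  conclude m n S S0≡m S1≡n S3≡0 S4≡0 (ranOut S' reach unchanged) =
    answers-after reach (reject S' (trans (unchanged 3 _ (λ ())) S3≡0) (trans (unchanged 4 _ (λ ())) S4≡0))

  diagonal-answers : ∀ m n → Answers 0 (Input m n) (verdict (run (suc n) D 0 GuestInput) m n)
  diagonal-answers m n =
    let S , reach , embeds , fuel , S0≡m , S1≡n , S3≡0 , S4≡0 = prepare m n
    in answers-after reach (conclude m n S S0≡m S1≡n S3≡0 S4≡0 (simulate n 0 GuestInput S embeds fuel S4≡0))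

  decode-selfCode : decode selfCode ≡ Q
  decode-selfCode = trans (cong decode selfCode-def) (decode-encode Q)

  computes : ∀ m n → Computes selfCode (m ∷ n ∷ []) (verdict (run (suc n) D 0 GuestInput) m n)
  computes m n =
    let t , halts = halts-with (diagonal-answers m n)
    in t , subst (λ P → run t P 0 (Input m n) ≡ just (verdict (run (suc n) D 0 GuestInput) m n))
                 (sym decode-selfCode) halts

  isClassCode : IsClassCode selfCode
  isClassCode m n =
    verdict (run (suc n) D 0 GuestInput) m n , computes m n , verdict≤1 (run (suc n) D 0 GuestInput) m n

  accepted : ∀ {t₀} → run t₀ D 0 GuestInput ≡ just 1 → ∀ m x → t₀ ≤ x → classOf isClassCode m x ≡ threshold m x
  accepted says-1 m x t₀≤x rewrite run-extend D 0 GuestInput (≤-trans t₀≤x (n≤1+n x)) says-1 = refl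

  rejected : ∀ {t₀} → run t₀ D 0 GuestInput ≡ just 0 → ∀ m x → classOf isClassCode m x ≡ 0
  rejected {t₀} says-0 m x = verdict-≢1 (run (suc x) D 0 GuestInput) m x
    λ says-1 → 1+n≢0 (run-deterministic {suc x} {t₀} D 0 GuestInput says-1 says-0)

corollary4p8 : ¬ (∃ λ (D : ℕ) → DecidesLdimFinite D)
corollary4p8 (d , decides) = refute (decides selfCode isClassCode)
  where
  open Diagonal (decode d)
  refute : (Computes d (selfCode ∷ []) 1 × LdimFinite (classOf isClassCode))
         ⊎ (Computes d (selfCode ∷ []) 0 × ¬ LdimFinite (classOf isClassCode)) → ⊥
  refute (inj₁ ((t₀ , says-finite) , finite))     = eventually-thresholds-ldim-infinite _ t₀ (accepted {t₀} says-finite) finite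
  refute (inj₂ ((t₀ , says-infinite) , infinite)) = infinite (zero-ldim-finite _ (rejected {t₀} says-infinite))
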